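{- A tree $(T;<)$ is antichain complete if and only if it is branching complete and every non-empty chain of branching points that is bounded below has an infimum.
   Context: A tree is a set $T$ with a strict partial order $<$ such that for every $x\in T$ the set $\{y:y<x\}$ is linearly ordered, and any two nodes have a common lower bound (no well-foundedness or root assumed). A chain is a linearly ordered set of nodes; an antichain is a set of pairwise incomparable nodes. Antichain complete: every non-empty antichain that is bounded below has an infimum. Branching complete: every pair of incomparable nodes has an infimum. A branching point is a node $t$ with $t=\inf\{u,v\}$ for some incomparable nodes $u,v$. -}

module Defs where

open import Level using (Level; _⊔_; suc; Lift)
open import Data.Product using (Σ; ∃; _×_; _,_)
open import Data.Sum using (_⊎_)
open import Relation.Nullary using (¬_)
open import Relation.Binary.PropositionalEquality using (_≡_)
open import Relation.Binary.Core using (Rel)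
open import Relation.Binary.Structures using (IsStrictPartialOrder)
open import Relation.Unary using (Pred; _∈_)

-- No root / well-foundedness is assumed.
record Tree (a ℓ : Level) : Set (suc (a ⊔ ℓ)) where
  field
    Carrier : Set a
    _<_     : Rel Carrier ℓ
    isStrictPartialOrder : IsStrictPartialOrder _≡_ _<_

  _≤_ : Rel Carrier (a ⊔ ℓ)
  x ≤ y = (x < y) ⊎ (x ≡ y)

  Comparable : Rel Carrier (a ⊔ ℓ)
  Comparable x y = (x < y) ⊎ (x ≡ y) ⊎ (y < x)

  Incomparable : Rel Carrier (a ⊔ ℓ)
  Incomparable x y = ¬ Comparable x y

  field
    predecessorsLinear : ∀ x y z → y < x → z < x → Comparable y z
    commonLowerBound   : ∀ x y → ∃ λ z → (z ≤ x) × (z ≤ y)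

module TreeNotions {a ℓ : Level} (T : Tree a ℓ) where
  open Tree T

  Subset : Set (suc (a ⊔ ℓ))
  Subset = Pred Carrier (a ⊔ ℓ)

  IsChain : Subset → Set (a ⊔ ℓ)
  IsChain S = ∀ x y → x ∈ S → y ∈ S → Comparable x y

  IsAntichain : Subset → Set (a ⊔ ℓ)
  IsAntichain S = ∀ x y → x ∈ S → y ∈ S → ¬ (x ≡ y) → Incomparable x y

  NonEmpty : Subset → Set (a ⊔ ℓ)
  NonEmpty S = ∃ λ x → x ∈ S

  IsLowerBound : Carrier → Subset → Set (a ⊔ ℓ)
  IsLowerBound b S = ∀ x → x ∈ S → b ≤ x

  BoundedBelow : Subset → Set (a ⊔ ℓ)
  BoundedBelow S = ∃ λ b → IsLowerBound b S

  IsInfimum : Carrier → Subset → Set (a ⊔ ℓ)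
  IsInfimum t S = IsLowerBound t S × (∀ c → IsLowerBound c S → c ≤ t)

  HasInfimum : Subset → Set (a ⊔ ℓ)
  HasInfimum S = ∃ λ t → IsInfimum t S

  Pair : Carrier → Carrier → Subset
  Pair u v x = Lift (a ⊔ ℓ) ((x ≡ u) ⊎ (x ≡ v))

  AntichainComplete : Set (suc (a ⊔ ℓ))
  AntichainComplete =
    ∀ (A : Subset) → IsAntichain A → NonEmpty A → BoundedBelow A → HasInfimum A

  BranchingComplete : Set (a ⊔ ℓ)
  BranchingComplete = ∀ u v → Incomparable u v → HasInfimum (Pair u v)

  IsBranchingPoint : Carrier → Set (a ⊔ ℓ)
  IsBranchingPoint t = ∃ λ u → ∃ λ v → Incomparable u v × IsInfimum t (Pair u v)

  BranchingChainComplete : Set (suc (a ⊔ ℓ))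
  BranchingChainComplete =
    ∀ (C : Subset) → IsChain C → (∀ x → x ∈ C → IsBranchingPoint x) →
    NonEmpty C → BoundedBelow C → HasInfimum C

-- Forward: a bounded chain C of branching points without a least element
-- is replaced by an antichain. At each c ∈ C = inf {u , v}, one of u, v
-- is incomparable with every d ∈ C above c (above a branching point a
-- chain can follow only one branch); picking such a node for every c gives
-- an antichain with the same lower bounds as C, and its infimum is the
-- infimum of C.
-- Backward: for an antichain A and a₀ ∈ A, the meets inf {a₀ , y}, y ∈ A
-- other than a₀, are branching points below a₀, hence a chain, and their
-- infimum is the infimum of A.
module Submission where

open import Defs
open import Level using (Level; _⊔_; lift)
open import Data.Product using (_×_; _,_; ∃; proj₁; proj₂)
open import Data.Sum using (_⊎_; inj₁; inj₂)
open import Data.Empty using (⊥; ⊥-elim)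
open import Relation.Nullary using (¬_; yes; no)
open import Relation.Binary.PropositionalEquality using (_≡_; refl; sym; isEquivalence)
open import Relation.Binary.Structures using (IsStrictPartialOrder)
import Relation.Binary.Construct.StrictToNonStrict as StrictToNonStrict
open import Relation.Unary using (Pred; _∈_)
open import Function.Bundles using (_⇔_; mk⇔)
open import Axiom.ExcludedMiddle using (ExcludedMiddle)

-- Excluded middle for `x ∈ P` makes the chosen value depend on x alone,
-- not on the membership proof.
em-select : ∀ {a b p r} {A : Set a} {B : Set b} {P : Pred A p} {R : A → B → Set r} →
            ExcludedMiddle p → B → (∀ x → x ∈ P → ∃ (R x)) →
            ∃ λ (f : A → B) → ∀ x → x ∈ P → R x (f x)
em-select {A = A} {B} {P} {R} em default choose = f , f-correct
  where
  f : A → B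
  f x with em {P = x ∈ P}
  ... | yes x∈P = proj₁ (choose x x∈P)
  ... | no _    = default

  f-correct : ∀ x → x ∈ P → R x (f x)
  f-correct x x∈P with em {P = x ∈ P}
  ... | yes x∈P′ = proj₂ (choose x x∈P′)
  ... | no x∉P   = ⊥-elim (x∉P x∈P)

module TreeProperties {a ℓ : Level} (T : Tree a ℓ) where
  open Tree T
  open TreeNotions T
  open IsStrictPartialOrder isStrictPartialOrder
    using (irrefl; <-resp-≈; <-respʳ-≈) renaming (trans to <-trans)

  <-irrefl : ∀ {x} → ¬ x < x
  <-irrefl = irrefl refl

  ≤-trans : ∀ {x y z} → x ≤ y → y ≤ z → x ≤ z
  ≤-trans = StrictToNonStrict.trans _≡_ _<_ isEquivalence <-resp-≈ <-trans

  <-≤-trans : ∀ {x y z} → x < y → y ≤ z → x < z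
  <-≤-trans = StrictToNonStrict.<-≤-trans _≡_ _<_ <-trans <-respʳ-≈

  ≤⇒Comparable : ∀ {x y} → x ≤ y → Comparable x y
  ≤⇒Comparable (inj₁ x<y) = inj₁ x<y
  ≤⇒Comparable (inj₂ x≡y) = inj₂ (inj₁ x≡y)

  Comparable⇒≤⊎> : ∀ {x y} → Comparable x y → (x ≤ y) ⊎ (y < x)
  Comparable⇒≤⊎> (inj₁ x<y)        = inj₁ (inj₁ x<y)
  Comparable⇒≤⊎> (inj₂ (inj₁ x≡y)) = inj₁ (inj₂ x≡y)
  Comparable⇒≤⊎> (inj₂ (inj₂ y<x)) = inj₂ y<x

  Comparable-sym : ∀ {x y} → Comparable x y → Comparable y x
  Comparable-sym (inj₁ x<y)        = inj₂ (inj₂ x<y)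
  Comparable-sym (inj₂ (inj₁ x≡y)) = inj₂ (inj₁ (sym x≡y))
  Comparable-sym (inj₂ (inj₂ y<x)) = inj₁ y<x

  Incomparable-sym : ∀ {x y} → Incomparable x y → Incomparable y x
  Incomparable-sym x∥y y~x = x∥y (Comparable-sym y~x)

  ≤-common-upper⇒Comparable : ∀ {x y z} → x ≤ z → y ≤ z → Comparable x y
  ≤-common-upper⇒Comparable {x} {y} {z} (inj₁ x<z) (inj₁ y<z) = predecessorsLinear z x y x<z y<z
  ≤-common-upper⇒Comparable (inj₁ x<z) (inj₂ refl) = inj₁ x<z
  ≤-common-upper⇒Comparable (inj₂ refl) y≤z        = Comparable-sym (≤⇒Comparable y≤z)

  ≤-Comparable-upper⇒Comparable : ∀ {x y z w} → Comparable z w → x ≤ z → y ≤ w → Comparable x y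
  ≤-Comparable-upper⇒Comparable z~w x≤z y≤w with Comparable⇒≤⊎> z~w
  ... | inj₁ z≤w = ≤-common-upper⇒Comparable (≤-trans x≤z z≤w) y≤w
  ... | inj₂ w<z = ≤-common-upper⇒Comparable x≤z (≤-trans y≤w (inj₁ w<z))

  Comparable⇒lowerBound-above : ∀ {c x y} → Comparable x y → c < x → c < y →
                                ∃ λ w → c < w × w ≤ x × w ≤ y
  Comparable⇒lowerBound-above {x = x} (inj₁ x<y)          c<x _   = x , c<x , inj₂ refl , inj₁ x<y
  Comparable⇒lowerBound-above {x = x} (inj₂ (inj₁ refl))  c<x _   = x , c<x , inj₂ refl , inj₂ refl
  Comparable⇒lowerBound-above {y = y} (inj₂ (inj₂ y<x))   _   c<y = y , c<y , inj₁ y<x , inj₂ refl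

  Pair-lowerBound : ∀ {t u v} → t ≤ u → t ≤ v → IsLowerBound t (Pair u v)
  Pair-lowerBound t≤u _ _ (lift (inj₁ refl)) = t≤u
  Pair-lowerBound _ t≤v _ (lift (inj₂ refl)) = t≤v

  Pair-∋ˡ : ∀ {u v} → u ∈ Pair u v
  Pair-∋ˡ = lift (inj₁ refl)

  Pair-∋ʳ : ∀ {u v} → v ∈ Pair u v
  Pair-∋ʳ = lift (inj₂ refl)

  Pair-isAntichain : ∀ {u v} → Incomparable u v → IsAntichain (Pair u v)
  Pair-isAntichain _   _ _ (lift (inj₁ refl)) (lift (inj₁ refl)) x≢y = ⊥-elim (x≢y refl)
  Pair-isAntichain u∥v _ _ (lift (inj₁ refl)) (lift (inj₂ refl)) _   = u∥v
  Pair-isAntichain u∥v _ _ (lift (inj₂ refl)) (lift (inj₁ refl)) _   = Incomparable-sym u∥v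
  Pair-isAntichain _   _ _ (lift (inj₂ refl)) (lift (inj₂ refl)) x≢y = ⊥-elim (x≢y refl)

  Pair-boundedBelow : ∀ u v → BoundedBelow (Pair u v)
  Pair-boundedBelow u v with commonLowerBound u v
  ... | z , z≤u , z≤v = z , Pair-lowerBound z≤u z≤v

  lowerBound-of-incomparable-pair-< : ∀ {c u v} → Incomparable u v → IsLowerBound c (Pair u v) →
                                      c < u × c < v
  lowerBound-of-incomparable-pair-< u∥v c≤uv = below (c≤uv _ Pair-∋ˡ) (c≤uv _ Pair-∋ʳ) u∥v
                                            , below (c≤uv _ Pair-∋ʳ) (c≤uv _ Pair-∋ˡ) (Incomparable-sym u∥v)
    where
    below : ∀ {c x y} → c ≤ x → c ≤ y → Incomparable x y → c < x
    below (inj₁ c<x) _   _   = c<x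
    below (inj₂ refl) c≤y x∥y = ⊥-elim (x∥y (≤⇒Comparable c≤y))

  minimum⇒infimum : ∀ {m S} → m ∈ S → IsLowerBound m S → IsInfimum m S
  minimum⇒infimum m∈S m≤S = m≤S , λ c c≤S → c≤S _ m∈S

  -- The nodes w₁ ≤ u, d₁ and w₂ ≤ v, d₂ strictly above c are comparable
  -- (as d₁, d₂ are), so the lower of them is a lower bound of {u , v} above c.
  branches-of-infimum-separated : ∀ {c u v d₁ d₂} → Incomparable u v → IsInfimum c (Pair u v) →
    c < d₁ → c < d₂ → Comparable d₁ d₂ → Comparable u d₁ → Comparable v d₂ → ⊥
  branches-of-infimum-separated u∥v (c≤uv , greatest) c<d₁ c<d₂ d₁~d₂ u~d₁ v~d₂
    with lowerBound-of-incomparable-pair-< u∥v c≤uv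
  ... | c<u , c<v
    with Comparable⇒lowerBound-above u~d₁ c<u c<d₁ | Comparable⇒lowerBound-above v~d₂ c<v c<d₂
  ... | w₁ , c<w₁ , w₁≤u , w₁≤d₁ | w₂ , c<w₂ , w₂≤v , w₂≤d₂
    with Comparable⇒lowerBound-above (≤-Comparable-upper⇒Comparable d₁~d₂ w₁≤d₁ w₂≤d₂) c<w₁ c<w₂
  ... | w , c<w , w≤w₁ , w≤w₂ =
    <-irrefl (<-≤-trans c<w (greatest w (Pair-lowerBound (≤-trans w≤w₁ w₁≤u) (≤-trans w≤w₂ w₂≤v))))

  antichainComplete⇒branchingComplete : AntichainComplete → BranchingComplete
  antichainComplete⇒branchingComplete complete u v u∥v =
    complete (Pair u v) (Pair-isAntichain u∥v) (u , Pair-∋ˡ) (Pair-boundedBelow u v)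

module ClassicalTreeProperties (em : ∀ {ℓ₀} → ExcludedMiddle ℓ₀) {a ℓ : Level} (T : Tree a ℓ) where
  open Tree T
  open TreeNotions T
  open TreeProperties T

  HasMinimum : Subset → Set (a ⊔ ℓ)
  HasMinimum S = ∃ λ m → m ∈ S × IsLowerBound m S

  ¬HasMinimum⇒descending : ∀ {C} → IsChain C → ¬ HasMinimum C → ∀ c → c ∈ C → ∃ λ d → d ∈ C × d < c
  ¬HasMinimum⇒descending {C} chain noMinimum c c∈C with em {P = ∃ λ d → d ∈ C × d < c}
  ... | yes descent = descent
  ... | no ¬descent = ⊥-elim (noMinimum (c , c∈C , c≤C))
    where
    c≤C : IsLowerBound c C
    c≤C d d∈C with Comparable⇒≤⊎> (chain c d c∈C d∈C)
    ... | inj₁ c≤d = c≤d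
    ... | inj₂ d<c = ⊥-elim (¬descent (d , d∈C , d<c))

  BranchesOff : Subset → Carrier → Carrier → Set (a ⊔ ℓ)
  BranchesOff C c y = c < y × (∀ d → d ∈ C → c < d → Incomparable y d)

  branchingPoint⇒branchesOff : ∀ {C c} → IsChain C → IsBranchingPoint c → ∃ (BranchesOff C c)
  branchingPoint⇒branchesOff {C} {c} chain (u , v , u∥v , c≡inf)
    with lowerBound-of-incomparable-pair-< u∥v (proj₁ c≡inf)
       | em {P = ∃ λ d → d ∈ C × c < d × Comparable u d}
       | em {P = ∃ λ d → d ∈ C × c < d × Comparable v d}
  ... | c<u , _ | no ¬meetsU | _ = u , c<u , λ d d∈C c<d u~d → ¬meetsU (d , d∈C , c<d , u~d)
  ... | _ , c<v | yes _ | no ¬meetsV = v , c<v , λ d d∈C c<d v~d → ¬meetsV (d , d∈C , c<d , v~d)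
  ... | _ | yes (d₁ , d₁∈C , c<d₁ , u~d₁) | yes (d₂ , d₂∈C , c<d₂ , v~d₂) =
    ⊥-elim (branches-of-infimum-separated u∥v c≡inf c<d₁ c<d₂ (chain d₁ d₂ d₁∈C d₂∈C) u~d₁ v~d₂)

  branchesOff-Incomparable : ∀ {C c c′ y y′} → c < c′ → c′ ∈ C → BranchesOff C c y → c′ < y′ →
                             Incomparable y y′
  branchesOff-Incomparable c<c′ c′∈C (_ , y∥C) c′<y′ y~y′ =
    y∥C _ c′∈C c<c′ (≤-Comparable-upper⇒Comparable y~y′ (inj₂ refl) (inj₁ c′<y′))

  Image : Subset → (Carrier → Carrier) → Subset
  Image C f y = ∃ λ c → c ∈ C × y ≡ f c

  module BranchSelection {C : Subset} (chain : IsChain C) (f : Carrier → Carrier)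
                         (f-branchesOff : ∀ c → c ∈ C → BranchesOff C c (f c)) where

    <⇒Incomparable : ∀ {c c′} → c ∈ C → c′ ∈ C → c < c′ → Incomparable (f c) (f c′)
    <⇒Incomparable {c} {c′} c∈C c′∈C c<c′ =
      branchesOff-Incomparable c<c′ c′∈C (f-branchesOff c c∈C) (proj₁ (f-branchesOff c′ c′∈C))

    Image-isAntichain : IsAntichain (Image C f)
    Image-isAntichain _ _ (c , c∈C , refl) (c′ , c′∈C , refl) fc≢fc′ with chain c c′ c∈C c′∈C
    ... | inj₁ c<c′        = <⇒Incomparable c∈C c′∈C c<c′
    ... | inj₂ (inj₁ refl) = ⊥-elim (fc≢fc′ refl)
    ... | inj₂ (inj₂ c′<c) = Incomparable-sym (<⇒Incomparable c′∈C c∈C c′<c)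

    lowerBound⇒Image-lowerBound : ∀ {b} → IsLowerBound b C → IsLowerBound b (Image C f)
    lowerBound⇒Image-lowerBound b≤C _ (c , c∈C , refl) =
      ≤-trans (b≤C c c∈C) (inj₁ (proj₁ (f-branchesOff c c∈C)))

    -- If t were above c ∈ C, then f d ≥ t > c for any d < c in C, against f d branching off at d.
    Image-infimum⇒infimum : ∀ {t} → (∀ c → c ∈ C → ∃ λ d → d ∈ C × d < c) →
                            IsInfimum t (Image C f) → IsInfimum t C
    Image-infimum⇒infimum {t} descending (t≤Image , greatest) =
      t≤C , λ b b≤C → greatest b (lowerBound⇒Image-lowerBound b≤C)
      where
      t≤C : IsLowerBound t C
      t≤C c c∈C with Comparable⇒≤⊎> (≤-common-upper⇒Comparable (t≤Image _ (c , c∈C , refl))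
                                                               (inj₁ (proj₁ (f-branchesOff c c∈C))))
      ... | inj₁ t≤c = t≤c
      ... | inj₂ c<t with descending c c∈C
      ... | d , d∈C , d<c = ⊥-elim (
        proj₂ (f-branchesOff d d∈C) c c∈C d<c (inj₂ (inj₂ (<-≤-trans c<t (t≤Image _ (d , d∈C , refl))))))

  antichainComplete⇒branchingChainComplete : AntichainComplete → BranchingChainComplete
  antichainComplete⇒branchingChainComplete complete C chain branching (c₀ , c₀∈C) (b , b≤C)
    with em {P = HasMinimum C}
  ... | yes (m , m∈C , m≤C) = m , minimum⇒infimum m∈C m≤C
  ... | no noMinimum with em-select em c₀ (λ c c∈C → branchingPoint⇒branchesOff chain (branching c c∈C))
  ... | f , f-branchesOff =
    proj₁ infImage , Image-infimum⇒infimum (¬HasMinimum⇒descending chain noMinimum) (proj₂ infImage)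
    where
    open BranchSelection chain f f-branchesOff
    infImage : HasInfimum (Image C f)
    infImage = complete (Image C f) Image-isAntichain (f c₀ , c₀ , c₀∈C , refl)
                        (b , lowerBound⇒Image-lowerBound b≤C)

  antichain-member-≡⊎Incomparable : ∀ {A a₀ x} → IsAntichain A → a₀ ∈ A → x ∈ A → x ≡ a₀ ⊎ Incomparable a₀ x
  antichain-member-≡⊎Incomparable {a₀ = a₀} {x} antichain a₀∈A x∈A with em {P = x ≡ a₀}
  ... | yes x≡a₀ = inj₁ x≡a₀
  ... | no x≢a₀  = inj₂ (antichain a₀ x a₀∈A x∈A (λ a₀≡x → x≢a₀ (sym a₀≡x)))

  MeetsWith : Carrier → Subset → Subset
  MeetsWith a₀ A x = ∃ λ y → y ∈ A × Incomparable a₀ y × IsInfimum x (Pair a₀ y)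

  module Meets {A : Subset} {a₀ : Carrier} (branchingComplete : BranchingComplete)
               (antichain : IsAntichain A) (a₀∈A : a₀ ∈ A) where

    MeetsWith-≤ : ∀ x → x ∈ MeetsWith a₀ A → x ≤ a₀
    MeetsWith-≤ x (_ , _ , _ , x≤Pair , _) = x≤Pair a₀ Pair-∋ˡ

    MeetsWith-isChain : IsChain (MeetsWith a₀ A)
    MeetsWith-isChain x y x∈M y∈M = ≤-common-upper⇒Comparable (MeetsWith-≤ x x∈M) (MeetsWith-≤ y y∈M)

    MeetsWith-branching : ∀ x → x ∈ MeetsWith a₀ A → IsBranchingPoint x
    MeetsWith-branching x (y , _ , a₀∥y , x≡inf) = a₀ , y , a₀∥y , x≡inf

    lowerBound⇒MeetsWith-lowerBound : ∀ {b} → IsLowerBound b A → IsLowerBound b (MeetsWith a₀ A)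
    lowerBound⇒MeetsWith-lowerBound b≤A x (y , y∈A , _ , _ , greatest) =
      greatest _ (Pair-lowerBound (b≤A a₀ a₀∈A) (b≤A y y∈A))

    meet : ∀ {y} → y ∈ A → Incomparable a₀ y → ∃ λ m → m ∈ MeetsWith a₀ A × m ≤ y
    meet {y} y∈A a₀∥y with branchingComplete a₀ y a₀∥y
    ... | m , m≡inf = m , (y , y∈A , a₀∥y , m≡inf) , proj₁ m≡inf y Pair-∋ʳ

    MeetsWith-infimum⇒infimum : ∀ {t y} → y ∈ A → Incomparable a₀ y →
                                IsInfimum t (MeetsWith a₀ A) → IsInfimum t A
    MeetsWith-infimum⇒infimum {t} y∈A a₀∥y (t≤M , greatest) =
      t≤A , λ b b≤A → greatest b (lowerBound⇒MeetsWith-lowerBound b≤A)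
      where
      t≤A : IsLowerBound t A
      t≤A x x∈A with antichain-member-≡⊎Incomparable antichain a₀∈A x∈A
      ... | inj₁ refl with meet y∈A a₀∥y
      ...   | m , m∈M , _ = ≤-trans (t≤M m m∈M) (MeetsWith-≤ m m∈M)
      t≤A x x∈A | inj₂ a₀∥x with meet x∈A a₀∥x
      ...   | m , m∈M , m≤x = ≤-trans (t≤M m m∈M) m≤x

  branchingComplete⇒antichainComplete : BranchingComplete → BranchingChainComplete → AntichainComplete
  branchingComplete⇒antichainComplete branchingComplete chainComplete A antichain (a₀ , a₀∈A) (b , b≤A)
    with em {P = ∃ λ y → y ∈ A × Incomparable a₀ y}
  ... | no onlyA₀ = a₀ , minimum⇒infimum a₀∈A a₀≤A
    where
    a₀≤A : IsLowerBound a₀ A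
    a₀≤A x x∈A with antichain-member-≡⊎Incomparable antichain a₀∈A x∈A
    ... | inj₁ x≡a₀ = inj₂ (sym x≡a₀)
    ... | inj₂ a₀∥x = ⊥-elim (onlyA₀ (x , x∈A , a₀∥x))
  ... | yes (y , y∈A , a₀∥y) = proj₁ infMeets , MeetsWith-infimum⇒infimum y∈A a₀∥y (proj₂ infMeets)
    where
    open Meets branchingComplete antichain a₀∈A
    infMeets : HasInfimum (MeetsWith a₀ A)
    infMeets = chainComplete (MeetsWith a₀ A) MeetsWith-isChain MeetsWith-branching
                 (proj₁ (meet y∈A a₀∥y) , proj₁ (proj₂ (meet y∈A a₀∥y)))
                 (b , lowerBound⇒MeetsWith-lowerBound b≤A)

mainTheorem6 : (∀ {ℓ₀} → ExcludedMiddle ℓ₀) → ∀ {a ℓ : Level} (T : Tree a ℓ) →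
    let open TreeNotions T in
    AntichainComplete ⇔ (BranchingComplete × BranchingChainComplete)
mainTheorem6 em T = mk⇔
  (λ complete → antichainComplete⇒branchingComplete complete
              , antichainComplete⇒branchingChainComplete complete)
  (λ (branching , chain) → branchingComplete⇒antichainComplete branching chain)
  where
  open TreeProperties T
  open ClassicalTreeProperties em T
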